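{- For every admissible pair $\tau$ for $S_n$ and every factorization type $\sigma$ of degree $n$, $\tau\lesssim\tau_\sigma$ if and only if $\tau_{s(\tau)}\lesssim\tau_\sigma$.
   Context: Admissible pair for $S_n$: $\tau=(H_\tau,g_\tau H_\tau)$ with $H_\tau\le S_n$ and $g_\tau H_\tau=H_\tau g_\tau$; $\tau'\le\tau$ iff $H_{\tau'}\subset H_\tau$ and $g_{\tau'}\in g_\tau H_\tau$; $A\lesssim B$ means $A\le\lambda B\lambda^{ -1}$ for some $\lambda\in S_n$, where $\lambda(H,gH)\lambda^{ -1}=(\lambda H\lambda^{ -1},\lambda gH\lambda^{ -1})$. A factorization type of degree $n$ is a multiset $\{f_1^{e_1},\dots,f_r^{e_r}\}$ of positive integers with $\sum f_ie_i=n$. $s(\tau)$: with $H_{1,\tau}=\langle H_\tau,g_\tau\rangle$ and $\pi_1,\dots,\pi_r$ its orbits on $\{1,\dots,n\}$, the $H_\tau$-orbits in $\pi_i$ have common size $e_i$ and number $f_i$; $s(\tau)=\{f_i^{e_i}\}$. $\tau_\sigma$: choose a partition of $\{1,\dots,n\}$ into parts $\pi_{i,j}$ ($1\le i\le r$, $1\le j\le f_i$) with $|\pi_{i,j}|=e_i$; $H_\sigma\cong\prod_i S_{e_i}^{f_i}$ is the subgroup preserving each part, and $g_\sigma H_\sigma$ is the coset of permutations mapping $\pi_{i,j}$ to $\pi_{i,j+1}$ (indices mod $f_i$) for each $i$; $\tau_\sigma=(H_\sigma,g_\sigma H_\sigma)$, well defined up to $S_n$-conjugacy. -}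

module Defs where

open import Level using (0ℓ)
open import Data.Nat using (ℕ; zero; suc; _*_; _≤_)
open import Data.Nat.DivMod using (_mod_)
open import Data.Fin using (Fin; toℕ)
open import Data.Fin.Permutation using (Permutation′; _⟨$⟩ʳ_; _∘ₚ_; flip; id; _≈_)
open import Data.Product using (Σ; Σ-syntax; ∃; ∃-syntax; _×_; _,_; proj₁; proj₂)
open import Data.List using (List; length; lookup; map)
open import Data.Nat.ListAction using (sum)
open import Data.List.Membership.Propositional using (_∈_)
open import Data.List.Relation.Unary.All using (All)
open import Data.List.Relation.Unary.Any using (Any)
open import Data.List.Relation.Unary.AllPairs using (AllPairs)
open import Data.List.Relation.Unary.Unique.Propositional using (Unique)
open import Data.List.Relation.Binary.Pointwise using (Pointwise)
open import Data.List.Relation.Binary.Permutation.Propositional using (_↭_)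
open import Relation.Binary.PropositionalEquality using (_≡_)
open import Relation.Nullary using (¬_)
open import Data.Unit using (⊤)
open import Function.Bundles using (_⇔_)

-- The symmetric group S_n, acting on {1,…,n} = Fin n.
-- Convention: (x · y) applied to i is x (y i)  (act on the left).

Perm : ℕ → Set
Perm n = Permutation′ n

infixl 7 _·_
_·_ : ∀ {n} → Perm n → Perm n → Perm n
x · y = y ∘ₚ x

_⁻¹ : ∀ {n} → Perm n → Perm n
x ⁻¹ = flip x

record Subgroup (n : ℕ) : Set₁ where
  field
    _∋_     : Perm n → Set
    resp    : ∀ {x y} → x ≈ y → _∋_ x → _∋_ y
    has-id  : _∋_ id
    closed· : ∀ {x y} → _∋_ x → _∋_ y → _∋_ (x · y)
    closed⁻ : ∀ {x} → _∋_ x → _∋_ (x ⁻¹)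
open Subgroup public

InLeftCoset : ∀ {n} → Perm n → Subgroup n → Perm n → Set
InLeftCoset {n} g H x = Σ[ h ∈ Perm n ] ((H ∋ h) × (x ≈ g · h))

InRightCoset : ∀ {n} → Perm n → Subgroup n → Perm n → Set
InRightCoset {n} g H x = Σ[ h ∈ Perm n ] ((H ∋ h) × (x ≈ h · g))

-- Admissible pairs τ = (H_τ , g_τ H_τ) with g_τ H_τ = H_τ g_τ.
-- The coset is represented by a representative g; all notions below
-- depend on g only through the coset g H.

record AdmPair (n : ℕ) : Set₁ where
  field
    H      : Subgroup n
    g      : Perm n
    normal : ∀ x → InLeftCoset g H x ⇔ InRightCoset g H x
open AdmPair public

_∈Coset_ : ∀ {n} → Perm n → AdmPair n → Set
x ∈Coset τ = InLeftCoset (g τ) (H τ) x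

_≤A_ : ∀ {n} → AdmPair n → AdmPair n → Set
τ' ≤A τ = (∀ x → H τ' ∋ x → H τ ∋ x) × (g τ' ∈Coset τ)

-- τ' ≤ λ τ λ⁻¹, unfolded: λ τ λ⁻¹ = (λ H λ⁻¹ , λ g H λ⁻¹), so
-- x ∈ λ H λ⁻¹ iff λ⁻¹ x λ ∈ H, and x ∈ λ g H λ⁻¹ iff λ⁻¹ x λ ∈ g H.
_≤Conj[_]_ : ∀ {n} → AdmPair n → Perm n → AdmPair n → Set
τ' ≤Conj[ l ] τ =
  (∀ x → H τ' ∋ x → H τ ∋ (l ⁻¹ · x · l)) × ((l ⁻¹ · g τ' · l) ∈Coset τ)

_≲_ : ∀ {n} → AdmPair n → AdmPair n → Set
_≲_ {n} A B = Σ[ l ∈ Perm n ] (A ≤Conj[ l ] B)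

HasSize : ∀ {n} → (Fin n → Set) → ℕ → Set
HasSize {n} P e = Σ[ ks ∈ List (Fin n) ]
  (Unique ks × All P ks × (∀ k → P k → k ∈ ks) × (length ks ≡ e))

-- rs is a list of representatives, one for each R-class contained in P
-- (R an equivalence relation); its length is the number of such classes
Transversal : ∀ {n} → (Fin n → Fin n → Set) → (Fin n → Set) → List (Fin n) → Set
Transversal R P rs =
  All P rs × (∀ j → P j → Any (λ r → R r j) rs) × AllPairs (λ a b → ¬ R a b) rs

-- the subgroup H_{1,τ} = ⟨H_τ , g_τ⟩ generated by H_τ and g_τ
data InGen {n : ℕ} (τ : AdmPair n) : Perm n → Set where
  gen-H   : ∀ {x} → H τ ∋ x → InGen τ x
  gen-g   : InGen τ (g τ)
  gen-id  : InGen τ id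
  gen-·   : ∀ {x y} → InGen τ x → InGen τ y → InGen τ (x · y)
  gen-⁻¹  : ∀ {x} → InGen τ x → InGen τ (x ⁻¹)
  gen-≈   : ∀ {x y} → x ≈ y → InGen τ x → InGen τ y

SameHOrbit : ∀ {n} → AdmPair n → Fin n → Fin n → Set
SameHOrbit {n} τ i j = Σ[ h ∈ Perm n ] ((H τ ∋ h) × (h ⟨$⟩ʳ i ≡ j))

SameGOrbit : ∀ {n} → AdmPair n → Fin n → Fin n → Set
SameGOrbit {n} τ i j = Σ[ x ∈ Perm n ] (InGen τ x × (x ⟨$⟩ʳ i ≡ j))

-- Factorization types of degree n: multisets {f_1^{e_1},…,f_r^{e_r}}
-- of positive integers with Σ f_i e_i = n, represented by a list of
-- pairs (f_i , e_i), considered up to reordering (_↭_).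

record FactType (n : ℕ) : Set where
  field
    pairs    : List (ℕ × ℕ)
    f-pos    : All (λ p → 1 ≤ proj₁ p) pairs
    e-pos    : All (λ p → 1 ≤ proj₂ p) pairs
    degree   : sum (map (λ p → proj₁ p * proj₂ p) pairs) ≡ n
open FactType public

-- s(τ): the H_{1,τ}-orbit of r has H_τ-orbits all of size e, and f of them.

OrbitType : ∀ {n} → AdmPair n → Fin n → ℕ × ℕ → Set
OrbitType τ r (f , e) =
  (∀ j → SameGOrbit τ r j → HasSize (SameHOrbit τ j) e) ×
  Σ[ hs ∈ List _ ] (Transversal (SameHOrbit τ) (SameGOrbit τ r) hs × length hs ≡ f)

-- σ = s(τ): listing the H_{1,τ}-orbits π_1,…,π_r (via representatives rs),
-- σ is the multiset of the pairs (f_i , e_i).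
IsS : ∀ {n} → AdmPair n → FactType n → Set
IsS {n} τ σ = Σ[ rs ∈ List (Fin n) ] Σ[ ps ∈ List (ℕ × ℕ) ]
  (Transversal (SameGOrbit τ) (λ _ → ⊤) rs ×
   Pointwise (OrbitType τ) rs ps ×
   (ps ↭ pairs σ))

-- τ_σ: parts π_{i,j} labelled by (i , j) with i < r, j < f_i.

fᵢ : ∀ {n} (σ : FactType n) → Fin (length (pairs σ)) → ℕ
fᵢ σ i = proj₁ (lookup (pairs σ) i)

eᵢ : ∀ {n} (σ : FactType n) → Fin (length (pairs σ)) → ℕ
eᵢ σ i = proj₂ (lookup (pairs σ) i)

PartLabel : ∀ {n} → FactType n → Set
PartLabel σ = Σ[ i ∈ Fin (length (pairs σ)) ] Fin (fᵢ σ i)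

next : ∀ {m} → Fin m → Fin m
next {suc m} j = suc (toℕ j) mod suc m

shift : ∀ {n} {σ : FactType n} → PartLabel σ → PartLabel σ
shift (i , j) = i , next j

-- T is (a representative of) τ_σ for the partition given by lab:
-- part π_{i,j} = lab⁻¹(i , j) has size e_i; H_T is the set of permutations
-- preserving every part; g_T H_T is the set of permutations mapping
-- π_{i,j} to π_{i,j+1} (indices mod f_i).
IsTauSigma : ∀ {n} → FactType n → AdmPair n → Set
IsTauSigma {n} σ T = Σ[ lab ∈ (Fin n → PartLabel σ) ]
  ((∀ p → HasSize (λ k → lab k ≡ p) (eᵢ σ (proj₁ p))) ×
   (∀ x → (H T ∋ x) ⇔ (∀ k → lab (x ⟨$⟩ʳ k) ≡ lab k)) ×
   (∀ x → (x ∈Coset T) ⇔ (∀ k → lab (x ⟨$⟩ʳ k) ≡ shift {σ = σ} (lab k))))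

{-# OPTIONS --safe #-}
-- Both sides are statements about labellings. If lab labels the points by the parts (i , j) of
-- τ_σ, then A ≤ λ τ_σ λ⁻¹ says exactly that lab ∘ λ⁻¹ is constant on the H_A-orbits and that g_A
-- moves the label (i , j) to (i , j + 1). The pair τ itself carries such a labelling by s(τ)
-- whose fibres are precisely the H_τ-orbits: as g_τ normalises H_τ, it permutes the H_τ-orbits
-- inside each ⟨H_τ , g_τ⟩-orbit cyclically, so these are the orbits of r, g r, …, g^(f-1) r for a
-- representative r, and the orbit of g^j r gets the label (i , j). The labelling of τ_{s(τ)} has
-- the same fibre sizes, so the two differ by a permutation ρ, and both have the H-orbits as
-- fibres. Hence a labelling compatible with one of τ, τ_{s(τ)} factors through its orbit
-- labelling and, moved along ρ, becomes compatible with the other.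
module Submission where

open import Defs
open import Data.Nat using (ℕ; zero; suc; _+_; _*_; _∸_; _<_; _≤_; _<?_; _%_; _/_)
open import Data.Nat.Properties
  using ( +-identityʳ; +-comm; +-assoc; +-suc; m+[n∸m]≡n; m<n⇒0<n∸m; m∸n≤m; ≤-<-trans; <⇒≤; <-cmp
        ; ≤-antisym; n<1+n)
open import Data.Nat.DivMod using (_mod_; m≡m%n+[m/n]*n; m%n<n)
open import Data.Fin using (Fin; toℕ; cast; fromℕ; fromℕ<) renaming (zero to fzero; suc to fsuc)
open import Data.Fin.Properties
  using ( _≟_; toℕ-fromℕ; toℕ-fromℕ<; toℕ-inject; toℕ<n; toℕ-injective; cast-involutive; pigeonhole
        ; injective⇒≤; ¬∀⟶∃¬-smallest)
open import Data.Fin.Permutation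
  using ( Permutation; _⟨$⟩ʳ_; _⟨$⟩ˡ_; _∘ₚ_; inverseˡ; inverseʳ; permutation; transpose; cast-id; flip; id
        ; _≈_)
open import Data.List using (List; length; lookup)
open import Data.List.Membership.Propositional using (_∈_)
open import Data.List.Membership.Propositional.Properties using (∈-lookup)
import Data.List.Relation.Unary.All as All
open import Data.List.Relation.Unary.Any using (index; any?)
open import Data.List.Relation.Unary.Any.Properties using (lookup-index)
open import Data.List.Relation.Unary.AllPairs using (AllPairs; _∷_)
open import Data.List.Relation.Binary.Pointwise using (Pointwise; Pointwise-length; lookup⁺)
open import Data.List.Relation.Binary.Permutation.Propositional using (_↭_; ↭⇒↭ₛ)
open import Data.List.Relation.Binary.Permutation.Homogeneous using (onIndices)
open import Data.List.Relation.Binary.Permutation.Setoid.Properties using (onIndices-lookup)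
open import Data.Product using (Σ; Σ-syntax; _×_; _,_; proj₁; proj₂; swap)
open import Data.Unit using (⊤; tt)
open import Data.Empty using (⊥-elim)
open import Function using (_∘_)
open import Function.Bundles using (_⇔_; mk⇔; module Equivalence)
open import Function.Definitions using (Injective)
open import Relation.Binary.Bundles using (Setoid)
import Relation.Binary.Reasoning.Setoid as SetoidReasoning
open import Relation.Binary.Definitions using (Symmetric; tri<; tri≈; tri>)
open import Relation.Unary using (Decidable)
open import Relation.Binary.PropositionalEquality
  using (_≡_; refl; sym; trans; cong; subst; setoid; module ≡-Reasoning)
open import Relation.Nullary using (¬_; yes; no; ¬?; contradiction)
open import Relation.Nullary.Decidable using (map′; decidable-stable; _×-dec_)

open Equivalence using (to; from)

⟨$⟩ʳ-injective : ∀ {m n} (π : Permutation m n) {a b} → π ⟨$⟩ʳ a ≡ π ⟨$⟩ʳ b → a ≡ b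
⟨$⟩ʳ-injective π e = trans (sym (inverseˡ π)) (trans (cong (π ⟨$⟩ˡ_) e) (inverseˡ π))

⟨$⟩ˡ-cong : ∀ {n} {x y : Perm n} → x ≈ y → ∀ k → x ⟨$⟩ˡ k ≡ y ⟨$⟩ˡ k
⟨$⟩ˡ-cong {x = x} {y} x≈y k =
  trans (sym (inverseˡ y)) (cong (y ⟨$⟩ˡ_) (trans (sym (x≈y _)) (inverseʳ x)))

relabelled-inverse : ∀ {n} {L : Set} {α β : Fin n → L} (ρ : Perm n) →
                     (∀ k → β (ρ ⟨$⟩ʳ k) ≡ α k) → ∀ k → α (ρ ⟨$⟩ˡ k) ≡ β k
relabelled-inverse {β = β} ρ ρ-relabels k = trans (sym (ρ-relabels _)) (cong β (inverseʳ ρ))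

transpose-moves : ∀ {n} (a b : Fin n) → transpose a b ⟨$⟩ʳ a ≡ b
transpose-moves a b with a ≟ a
... | yes _ = refl
... | no a≢a = contradiction refl a≢a

transpose-preserves : ∀ {n} {A : Set} (F : Fin n → A) {a b} → F a ≡ F b →
                      ∀ k → F (transpose a b ⟨$⟩ʳ k) ≡ F k
transpose-preserves F {a} {b} Fa≡Fb k with k ≟ a
... | yes refl = sym Fa≡Fb
... | no _ with k ≟ b
...   | yes refl = Fa≡Fb
...   | no _ = refl

least-witness : ∀ {P : ℕ → Set} → Decidable P → ∀ {d} → P d →
                Σ[ p ∈ ℕ ] (P p × (∀ {m} → m < p → ¬ P m))
least-witness {P} P? {d} Pd
  with ¬∀⟶∃¬-smallest (suc d) (¬_ ∘ P ∘ toℕ) (¬? ∘ P? ∘ toℕ)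
         (λ none → none (fromℕ d) (subst P (sym (toℕ-fromℕ d)) Pd))
... | p , ¬¬Pp , below = toℕ p , decidable-stable (P? (toℕ p)) ¬¬Pp ,
      λ m<p → subst (¬_ ∘ P) (trans (toℕ-inject _) (toℕ-fromℕ< m<p)) (below (fromℕ< m<p))

lookup-injective : ∀ {A : Set} {R : A → A → Set} → Symmetric R →
                   ∀ {xs} → AllPairs (λ a b → ¬ R a b) xs →
                   ∀ {i j} → R (lookup xs i) (lookup xs j) → i ≡ j
lookup-injective R-sym (_ ∷ _)     {fzero}  {fzero}  _ = refl
lookup-injective R-sym (apart ∷ _) {fzero}  {fsuc j} r = ⊥-elim (All.lookup apart (∈-lookup j) r)
lookup-injective R-sym (apart ∷ _) {fsuc i} {fzero}  r =
  ⊥-elim (All.lookup apart (∈-lookup i) (R-sym r))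
lookup-injective R-sym (_ ∷ rest)  {fsuc i} {fsuc j} r = cong fsuc (lookup-injective R-sym rest r)

HasSize-resp : ∀ {n} {P Q : Fin n → Set} {e} → (∀ {k} → P k → Q k) → (∀ {k} → Q k → P k) →
               HasSize P e → HasSize Q e
HasSize-resp P⇒Q Q⇒P (ks , unique , all , complete , len) =
  ks , unique , All.map P⇒Q all , (λ k → complete k ∘ Q⇒P) , len

HasSize⇒Decidable : ∀ {n} {P : Fin n → Set} {e} → HasSize P e → Decidable P
HasSize⇒Decidable (ks , _ , all , complete , _) k =
  map′ (All.lookup all) (complete k) (any? (k ≟_) ks)

module FibreCoordinates {n} {L : Set} (c : L → ℕ) (α : Fin n → L)
                        (fibre : ∀ q → HasSize (λ k → α k ≡ q) (c q)) where

  private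
    elements : L → List (Fin n)
    elements q = proj₁ (fibre q)

    length-elements : ∀ q → length (elements q) ≡ c q
    length-elements q = proj₂ (proj₂ (proj₂ (proj₂ (fibre q))))

    ∈-elements : ∀ k → k ∈ elements (α k)
    ∈-elements k = proj₁ (proj₂ (proj₂ (proj₂ (fibre (α k))))) k refl

  coord : Fin n → Σ L (Fin ∘ c)
  coord k = α k , cast (length-elements (α k)) (index (∈-elements k))

  point : Σ L (Fin ∘ c) → Fin n
  point (q , i) = lookup (elements q) (cast (sym (length-elements q)) i)

  point-coord : ∀ k → point (coord k) ≡ k
  point-coord k =
    trans (cong (lookup (elements (α k))) (cast-involutive _ (length-elements (α k)) _))
          (sym (lookup-index (∈-elements k)))

  coord-point : ∀ x → coord (point x) ≡ x
  coord-point (q , i) = coord-unique (All.lookup (proj₁ (proj₂ (proj₂ (fibre q)))) (∈-lookup _)) refl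
    where
    coord-unique : ∀ {k q} {i : Fin (c q)} → α k ≡ q → point (q , i) ≡ k → coord k ≡ (q , i)
    coord-unique {k} {i = i} refl point≡k = cong (α k ,_) (begin
      cast len (index (∈-elements k))            ≡⟨ cong (cast len) same-index ⟩
      cast len (cast (sym len) i)                ≡⟨ cast-involutive len (sym len) i ⟩
      i                                              ∎)
      where
      open ≡-Reasoning
      len : length (elements (α k)) ≡ c (α k)
      len = length-elements (α k)
      same-index : index (∈-elements k) ≡ cast (sym len) i
      same-index = lookup-injective sym (proj₁ (proj₂ (fibre (α k))))
                     (trans (sym (lookup-index (∈-elements k))) (sym point≡k))

equalFibreSizes⇒relabelling :
  ∀ {n} {L : Set} (c : L → ℕ) {α β : Fin n → L} →
  (∀ q → HasSize (λ k → α k ≡ q) (c q)) → (∀ q → HasSize (λ k → β k ≡ q) (c q)) →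
  Σ[ ρ ∈ Perm n ] (∀ k → β (ρ ⟨$⟩ʳ k) ≡ α k)
equalFibreSizes⇒relabelling c α-fibres β-fibres =
  permutation (B.point ∘ A.coord) (A.point ∘ B.coord)
    (λ k → trans (cong B.point (A.coord-point (B.coord k))) (B.point-coord k))
    (λ k → trans (cong A.point (B.coord-point (A.coord k))) (A.point-coord k)) ,
  λ k → cong proj₁ (B.coord-point (A.coord k))
  where
  module A = FibreCoordinates c _ α-fibres
  module B = FibreCoordinates c _ β-fibres

module Orbits {n : ℕ} (τ : AdmPair n) where

  infix 4 _~_ _~ᴳ_

  _~_ : Fin n → Fin n → Set
  _~_ = SameHOrbit τ

  _~ᴳ_ : Fin n → Fin n → Set
  _~ᴳ_ = SameGOrbit τ

  ~-refl : ∀ {a} → a ~ a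
  ~-refl = id , has-id (H τ) , refl

  ~-sym : ∀ {a b} → a ~ b → b ~ a
  ~-sym (h , h∈H , refl) = h ⁻¹ , closed⁻ (H τ) h∈H , inverseˡ h

  ~-trans : ∀ {a b c} → a ~ b → b ~ c → a ~ c
  ~-trans (h , h∈H , refl) (h′ , h′∈H , refl) = h′ · h , closed· (H τ) h′∈H h∈H , refl

  ~-setoid : Setoid _ _
  ~-setoid = record
    { Carrier = Fin n ; _≈_ = _~_
    ; isEquivalence = record { refl = ~-refl ; sym = ~-sym ; trans = ~-trans } }

  ~-by : ∀ {h} → H τ ∋ h → ∀ a → a ~ h ⟨$⟩ʳ a
  ~-by h∈H a = _ , h∈H , refl

  ~ᴳ-refl : ∀ {a} → a ~ᴳ a
  ~ᴳ-refl = id , gen-id , refl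

  ~ᴳ-sym : ∀ {a b} → a ~ᴳ b → b ~ᴳ a
  ~ᴳ-sym (x , x∈G , refl) = x ⁻¹ , gen-⁻¹ x∈G , inverseˡ x

  ~ᴳ-trans : ∀ {a b c} → a ~ᴳ b → b ~ᴳ c → a ~ᴳ c
  ~ᴳ-trans (x , x∈G , refl) (y , y∈G , refl) = y · x , gen-· y∈G x∈G , refl

  ~⇒~ᴳ : ∀ {a b} → a ~ b → a ~ᴳ b
  ~⇒~ᴳ (h , h∈H , a↦b) = h , gen-H h∈H , a↦b

  g-cong : ∀ {a b} → a ~ b → g τ ⟨$⟩ʳ a ~ g τ ⟨$⟩ʳ b
  g-cong {a} (h , h∈H , refl) with to (normal τ (g τ · h)) (h , h∈H , λ _ → refl)
  ... | h′ , h′∈H , gh≈h′g = h′ , h′∈H , sym (gh≈h′g a)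

  g-cancel : ∀ {a b} → g τ ⟨$⟩ʳ a ~ g τ ⟨$⟩ʳ b → a ~ b
  g-cancel {a} (h , h∈H , hga≡gb) with from (normal τ (h · g τ)) (h , h∈H , λ _ → refl)
  ... | h′ , h′∈H , hg≈gh′ = h′ , h′∈H , ⟨$⟩ʳ-injective (g τ) (trans (sym (hg≈gh′ a)) hga≡gb)

  infix 8 g^_

  g^_ : ℕ → Perm n
  g^ zero  = id
  g^ suc j = g τ · g^ j

  g^-+ : ∀ i j a → g^ (i + j) ⟨$⟩ʳ a ≡ g^ i ⟨$⟩ʳ (g^ j ⟨$⟩ʳ a)
  g^-+ zero    j a = refl
  g^-+ (suc i) j a = cong (g τ ⟨$⟩ʳ_) (g^-+ i j a)

  g^-cong : ∀ j {a b} → a ~ b → g^ j ⟨$⟩ʳ a ~ g^ j ⟨$⟩ʳ b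
  g^-cong zero    a~b = a~b
  g^-cong (suc j) a~b = g-cong (g^-cong j a~b)

  g^-cancel : ∀ j {a b} → g^ j ⟨$⟩ʳ a ~ g^ j ⟨$⟩ʳ b → a ~ b
  g^-cancel zero    w = w
  g^-cancel (suc j) w = g^-cancel j (g-cancel w)

  g^-orbit : ∀ j a → a ~ᴳ g^ j ⟨$⟩ʳ a
  g^-orbit j a = g^ j , generated j , refl
    where
    generated : ∀ j → InGen τ (g^ j)
    generated zero    = gen-id
    generated (suc j) = gen-· gen-g (generated j)

  g^-difference : ∀ {r i j} → i ≤ j → g^ i ⟨$⟩ʳ r ~ g^ j ⟨$⟩ʳ r → r ~ g^ (j ∸ i) ⟨$⟩ʳ r
  g^-difference {r} {i} {j} i≤j gⁱr~gʲr = g^-cancel i (begin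
    g^ i ⟨$⟩ʳ r                        ≈⟨ gⁱr~gʲr ⟩
    g^ j ⟨$⟩ʳ r                        ≡⟨ cong (λ m → g^ m ⟨$⟩ʳ r) (m+[n∸m]≡n i≤j) ⟨
    g^ (i + (j ∸ i)) ⟨$⟩ʳ r            ≡⟨ g^-+ i (j ∸ i) r ⟩
    g^ i ⟨$⟩ʳ (g^ (j ∸ i) ⟨$⟩ʳ r)      ∎)
    where open SetoidReasoning ~-setoid

  InGen-closed : (S : Fin n → Set) →
                 (∀ {h k} → H τ ∋ h → S k → S (h ⟨$⟩ʳ k)) →
                 (∀ {k} → S k → S (g τ ⟨$⟩ʳ k)) → (∀ {k} → S k → S (g τ ⟨$⟩ˡ k)) →
                 ∀ {x k} → InGen τ x → S k → S (x ⟨$⟩ʳ k)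
  InGen-closed S H-closed g-closed g⁻¹-closed x∈G = proj₁ (closed x∈G)
    where
    closed : ∀ {x} → InGen τ x → (∀ {k} → S k → S (x ⟨$⟩ʳ k)) × (∀ {k} → S k → S (x ⟨$⟩ˡ k))
    closed (gen-H h∈H)   = H-closed h∈H , H-closed (closed⁻ (H τ) h∈H)
    closed gen-g         = g-closed , g⁻¹-closed
    closed gen-id        = (λ s → s) , (λ s → s)
    closed (gen-· x∈G y∈G) with closed x∈G | closed y∈G
    ... | x-closed , x⁻¹-closed | y-closed , y⁻¹-closed =
      (λ s → x-closed (y-closed s)) , (λ s → y⁻¹-closed (x⁻¹-closed s))
    closed (gen-⁻¹ x∈G)  = swap (closed x∈G)
    closed (gen-≈ {x} {y} x≈y x∈G) with closed x∈G
    ... | x-closed , x⁻¹-closed =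
      (λ {k} s → subst S (x≈y k) (x-closed s)) ,
      (λ {k} s → subst S (⟨$⟩ˡ-cong {x = x} {y} x≈y k) (x⁻¹-closed s))

  module Periodic {r : Fin n} (d : ℕ) (period : r ~ g^ suc d ⟨$⟩ʳ r) where
    open SetoidReasoning ~-setoid

    periodic : ∀ q i → g^ (i + q * suc d) ⟨$⟩ʳ r ~ g^ i ⟨$⟩ʳ r
    periodic zero    i = subst (λ m → g^ m ⟨$⟩ʳ r ~ g^ i ⟨$⟩ʳ r) (sym (+-identityʳ i)) ~-refl
    periodic (suc q) i = begin
      g^ (i + (suc d + q * suc d)) ⟨$⟩ʳ r      ≡⟨ cong (λ m → g^ m ⟨$⟩ʳ r) rearrange ⟩
      g^ (i + q * suc d + suc d) ⟨$⟩ʳ r        ≡⟨ g^-+ (i + q * suc d) (suc d) r ⟩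
      g^ (i + q * suc d) ⟨$⟩ʳ (g^ suc d ⟨$⟩ʳ r) ≈⟨ g^-cong (i + q * suc d) period ⟨
      g^ (i + q * suc d) ⟨$⟩ʳ r                ≈⟨ periodic q i ⟩
      g^ i ⟨$⟩ʳ r                              ∎
      where
      rearrange : i + (suc d + q * suc d) ≡ i + q * suc d + suc d
      rearrange = trans (cong (i +_) (+-comm (suc d) (q * suc d)))
                        (sym (+-assoc i (q * suc d) (suc d)))

    reduce : ∀ m → g^ toℕ (m mod suc d) ⟨$⟩ʳ r ~ g^ m ⟨$⟩ʳ r
    reduce m = begin
      g^ toℕ (m mod suc d) ⟨$⟩ʳ r                ≡⟨ cong g^-r (toℕ-fromℕ< (m%n<n m (suc d))) ⟩
      g^ (m % suc d) ⟨$⟩ʳ r                      ≈⟨ periodic (m / suc d) (m % suc d) ⟨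
      g^ (m % suc d + m / suc d * suc d) ⟨$⟩ʳ r  ≡⟨ cong g^-r (m≡m%n+[m/n]*n m (suc d)) ⟨
      g^ m ⟨$⟩ʳ r                                ∎
      where
      g^-r : ℕ → Fin n
      g^-r j = g^ j ⟨$⟩ʳ r

    power : ∀ {k} → r ~ᴳ k → Σ[ m ∈ ℕ ] (g^ m ⟨$⟩ʳ r ~ k)
    power (x , x∈G , refl) =
      InGen-closed Power (λ h∈H (m , w) → m , ~-trans w (~-by h∈H _))
        (λ (m , w) → suc m , g-cong w) backwards x∈G (0 , ~-refl)
      where
      Power : Fin n → Set
      Power k = Σ[ m ∈ ℕ ] (g^ m ⟨$⟩ʳ r ~ k)

      backwards : ∀ {k} → Power k → Power (g τ ⟨$⟩ˡ k)
      backwards {k} (m , w) = m + d , g-cancel (begin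
        g^ suc (m + d) ⟨$⟩ʳ r                ≡⟨ cong (λ j → g^ j ⟨$⟩ʳ r) (+-suc m d) ⟨
        g^ (m + suc d) ⟨$⟩ʳ r                ≡⟨ g^-+ m (suc d) r ⟩
        g^ m ⟨$⟩ʳ (g^ suc d ⟨$⟩ʳ r)          ≈⟨ g^-cong m period ⟨
        g^ m ⟨$⟩ʳ r                          ≈⟨ w ⟩
        k                                    ≡⟨ inverseʳ (g τ) ⟨
        g τ ⟨$⟩ʳ (g τ ⟨$⟩ˡ k)                ∎)

  IsPeriod : Fin n → ℕ → Set
  IsPeriod r p = 0 < p × r ~ g^ p ⟨$⟩ʳ r

  record CyclicOrbit (r : Fin n) (f : ℕ) : Set where
    field
      position : ∀ {k} → r ~ᴳ k → Σ[ j ∈ Fin f ] (g^ toℕ j ⟨$⟩ʳ r ~ k)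
      distinct : ∀ {i j : Fin f} → g^ toℕ i ⟨$⟩ʳ r ~ g^ toℕ j ⟨$⟩ʳ r → i ≡ j
      step     : ∀ (j : Fin f) → g^ toℕ (next j) ⟨$⟩ʳ r ~ g τ ⟨$⟩ʳ (g^ toℕ j ⟨$⟩ʳ r)

  minimalPeriod⇒cyclic : ∀ {r p} → IsPeriod r p → (∀ {m} → m < p → ¬ IsPeriod r m) → CyclicOrbit r p
  minimalPeriod⇒cyclic {p = zero} (() , _)
  minimalPeriod⇒cyclic {r} {suc d} (_ , period) minimal = record
    { position = λ w → let (m , gᵐr~k) = power w in m mod suc d , ~-trans (reduce m) gᵐr~k
    ; distinct = distinct
    ; step     = λ j → reduce (suc (toℕ j))
    }
    where
    open Periodic d period

    earlier-not-related : ∀ {i j : Fin (suc d)} → toℕ i < toℕ j →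
                          ¬ g^ toℕ i ⟨$⟩ʳ r ~ g^ toℕ j ⟨$⟩ʳ r
    earlier-not-related {i} {j} i<j w =
      minimal (≤-<-trans (m∸n≤m (toℕ j) (toℕ i)) (toℕ<n j))
              (m<n⇒0<n∸m i<j , g^-difference (<⇒≤ i<j) w)

    distinct : ∀ {i j : Fin (suc d)} → g^ toℕ i ⟨$⟩ʳ r ~ g^ toℕ j ⟨$⟩ʳ r → i ≡ j
    distinct {i} {j} w with <-cmp (toℕ i) (toℕ j)
    ... | tri< i<j _ _ = ⊥-elim (earlier-not-related i<j w)
    ... | tri≈ _ i≡j _ = toℕ-injective i≡j
    ... | tri> _ _ j<i = ⊥-elim (earlier-not-related j<i (~-sym w))

  module _ {r : Fin n} {hs : List (Fin n)} (hs-transversal : Transversal _~_ (r ~ᴳ_) hs) where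

    private
      slot : ∀ {k} → r ~ᴳ k → Fin (length hs)
      slot {k} w = index (proj₁ (proj₂ hs-transversal) k w)

      slot-~ : ∀ {k} (w : r ~ᴳ k) → lookup hs (slot w) ~ k
      slot-~ {k} w = lookup-index (proj₁ (proj₂ hs-transversal) k w)

      same-slot⇒~ : ∀ {a b} (wa : r ~ᴳ a) (wb : r ~ᴳ b) → slot wa ≡ slot wb → a ~ b
      same-slot⇒~ {b = b} wa wb same =
        ~-trans (~-sym (slot-~ wa)) (subst (λ t → lookup hs t ~ b) (sym same) (slot-~ wb))

      power-slot : ℕ → Fin (length hs)
      power-slot j = slot (g^-orbit j r)

    period-exists : Σ[ p ∈ ℕ ] IsPeriod r p
    period-exists with pigeonhole (n<1+n (length hs)) (power-slot ∘ toℕ)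
    ... | i , j , i<j , same =
      toℕ j ∸ toℕ i , m<n⇒0<n∸m i<j , g^-difference (<⇒≤ i<j) (same-slot⇒~ _ _ same)

    cyclic-length : ∀ {p} → CyclicOrbit r p → p ≡ length hs
    cyclic-length {p} cyclic =
      ≤-antisym (injective⇒≤ slot-injective) (injective⇒≤ position-injective)
      where
      open CyclicOrbit cyclic

      slot-injective : Injective _≡_ _≡_ (power-slot ∘ toℕ {p})
      slot-injective same = distinct (same-slot⇒~ _ _ same)

      hs-position : ∀ t → Σ[ j ∈ Fin p ] (g^ toℕ j ⟨$⟩ʳ r ~ lookup hs t)
      hs-position t = position (All.lookup (proj₁ hs-transversal) (∈-lookup t))

      position-injective : Injective _≡_ _≡_ (proj₁ ∘ hs-position)
      position-injective {t} {t′} same =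
        lookup-injective ~-sym (proj₂ (proj₂ hs-transversal))
          (~-trans (~-sym (proj₂ (hs-position t)))
                   (subst (λ j → g^ toℕ j ⟨$⟩ʳ r ~ lookup hs t′) (sym same)
                          (proj₂ (hs-position t′))))

  -- Opaque, so that later type checking never unfolds the least-period search.
  opaque
    cyclicOrbit : ∀ {r f e} → OrbitType τ r (f , e) → CyclicOrbit r f
    cyclicOrbit {r} (sizes , hs , hs-transversal , length≡f) =
      subst (CyclicOrbit r) (trans (cyclic-length hs-transversal cyclic) length≡f) cyclic
      where
      isPeriod? : Decidable (IsPeriod r)
      isPeriod? m = 0 <? m ×-dec HasSize⇒Decidable (sizes r ~ᴳ-refl) (g^ m ⟨$⟩ʳ r)

      least-period : Σ[ p ∈ ℕ ] (IsPeriod r p × (∀ {m} → m < p → ¬ IsPeriod r m))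
      least-period = least-witness isPeriod? (proj₂ (period-exists hs-transversal))

      cyclic : CyclicOrbit r (proj₁ least-period)
      cyclic = minimalPeriod⇒cyclic (proj₁ (proj₂ least-period)) (proj₂ (proj₂ least-period))

record Compatible {n} {L : Set} (step : L → L) (A : AdmPair n) (μ : Fin n → L) : Set where
  field
    H-invariant : ∀ {x} → H A ∋ x → ∀ k → μ (x ⟨$⟩ʳ k) ≡ μ k
    g-steps     : ∀ k → μ (g A ⟨$⟩ʳ k) ≡ step (μ k)

  constant-on-orbits : ∀ {a b} → SameHOrbit A a b → μ a ≡ μ b
  constant-on-orbits (h , h∈H , refl) = sym (H-invariant h∈H _)

record OrbitLabelling {n} {L : Set} (step : L → L) (A : AdmPair n) (ν : Fin n → L) : Set where
  field
    compatible  : Compatible step A ν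
    fibre⇒orbit : ∀ {a b} → ν a ≡ ν b → SameHOrbit A a b

-- The labelling μ factors through νA, because νA separates H_A-orbits and μ is constant on them.
relabel-compatible :
  ∀ {n} {L M : Set} {s : L → L} {t : M → M} {A B : AdmPair n} {νA νB : Fin n → L} {μ : Fin n → M} →
  (ρ : Perm n) → OrbitLabelling s A νA → Compatible s B νB → (∀ k → νB (ρ ⟨$⟩ʳ k) ≡ νA k) →
  Compatible t A μ → Compatible t B (λ k → μ (ρ ⟨$⟩ˡ k))
relabel-compatible {s = s} {A = A} {B} {νA} {νB} {μ} ρ
                   νA-orbits νB-compatible ρ-relabels μ-compatible = record
    { H-invariant = λ x∈H k → factor (Compatible.H-invariant νB-compatible x∈H k)
    ; g-steps     = λ k → trans (factorA (νA-gB k)) (Compatible.g-steps μ-compatible _)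
    }
  where
  open ≡-Reasoning

  νA∘ρ⁻¹ : ∀ k → νA (ρ ⟨$⟩ˡ k) ≡ νB k
  νA∘ρ⁻¹ = relabelled-inverse ρ ρ-relabels

  factorA : ∀ {a b} → νA a ≡ νA b → μ a ≡ μ b
  factorA = Compatible.constant-on-orbits μ-compatible ∘ OrbitLabelling.fibre⇒orbit νA-orbits

  factor : ∀ {a b} → νB a ≡ νB b → μ (ρ ⟨$⟩ˡ a) ≡ μ (ρ ⟨$⟩ˡ b)
  factor {a} {b} νBa≡νBb = factorA (trans (νA∘ρ⁻¹ a) (trans νBa≡νBb (sym (νA∘ρ⁻¹ b))))

  νA-gB : ∀ k → νA (ρ ⟨$⟩ˡ (g B ⟨$⟩ʳ k)) ≡ νA (g A ⟨$⟩ʳ (ρ ⟨$⟩ˡ k))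
  νA-gB k = begin
    νA (ρ ⟨$⟩ˡ (g B ⟨$⟩ʳ k))   ≡⟨ νA∘ρ⁻¹ _ ⟩
    νB (g B ⟨$⟩ʳ k)            ≡⟨ Compatible.g-steps νB-compatible k ⟩
    s (νB k)                   ≡⟨ cong s (νA∘ρ⁻¹ k) ⟨
    s (νA (ρ ⟨$⟩ˡ k))          ≡⟨ Compatible.g-steps (OrbitLabelling.compatible νA-orbits) _ ⟨
    νA (g A ⟨$⟩ʳ (ρ ⟨$⟩ˡ k))   ∎

module TauSigma {n} (σ : FactType n) (T : AdmPair n) (T-is : IsTauSigma σ T) where

  label : Fin n → PartLabel σ
  label = proj₁ T-is

  label-fibres : ∀ q → HasSize (λ k → label k ≡ q) (eᵢ σ (proj₁ q))
  label-fibres = proj₁ (proj₂ T-is)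

  private
    H-iff : ∀ x → (H T ∋ x) ⇔ (∀ k → label (x ⟨$⟩ʳ k) ≡ label k)
    H-iff = proj₁ (proj₂ (proj₂ T-is))

    coset-iff : ∀ x → (x ∈Coset T) ⇔ (∀ k → label (x ⟨$⟩ʳ k) ≡ shift {σ = σ} (label k))
    coset-iff = proj₂ (proj₂ (proj₂ T-is))

    conjugate-label : ∀ (l x : Perm n) (F : PartLabel σ → PartLabel σ) →
      (∀ k → label ((l ⁻¹ · x · l) ⟨$⟩ʳ k) ≡ F (label k)) ⇔
      (∀ k → label (l ⟨$⟩ˡ (x ⟨$⟩ʳ k)) ≡ F (label (l ⟨$⟩ˡ k)))
    conjugate-label l x F = mk⇔
      (λ conj k → trans (cong (λ m → label (l ⟨$⟩ˡ (x ⟨$⟩ʳ m))) (sym (inverseʳ l)))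
                        (conj (l ⟨$⟩ˡ k)))
      (λ relabelled k → trans (relabelled (l ⟨$⟩ʳ k)) (cong (F ∘ label) (inverseˡ l)))

  ≤Conj⇔compatible : ∀ {A : AdmPair n} (l : Perm n) →
                     A ≤Conj[ l ] T ⇔ Compatible (shift {σ = σ}) A (λ k → label (l ⟨$⟩ˡ k))
  ≤Conj⇔compatible {A} l = mk⇔
    (λ (H⊆ , g∈) → record
      { H-invariant = λ {x} x∈H → to (conjugate-label l x (λ q → q)) (to (H-iff _) (H⊆ x x∈H))
      ; g-steps     = to (conjugate-label l (g A) (shift {σ = σ}))
                         (to (coset-iff (l ⁻¹ · g A · l)) g∈)
      })
    (λ compatible →
        (λ x x∈H → from (H-iff _)
                     (from (conjugate-label l x (λ q → q)) (Compatible.H-invariant compatible x∈H)))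
      , from (coset-iff (l ⁻¹ · g A · l))
          (from (conjugate-label l (g A) (shift {σ = σ})) (Compatible.g-steps compatible)))

  label-orbits : OrbitLabelling (shift {σ = σ}) T label
  label-orbits = record
    { compatible  = record
      { H-invariant = λ x∈H → to (H-iff _) x∈H
      ; g-steps     = to (coset-iff (g T)) (id , has-id (H T) , λ _ → refl)
      }
    ; fibre⇒orbit = λ {a} {b} same →
        transpose a b , from (H-iff _) (transpose-preserves label same) , transpose-moves a b
    }

module TypeLabelling {n} (τ : AdmPair n) (s : FactType n) (s-is : IsS τ s) where

  open Orbits τ

  private
    reps : List (Fin n)
    reps = proj₁ s-is

    types : List (ℕ × ℕ)
    types = proj₁ (proj₂ s-is)

    reps-transversal : Transversal _~ᴳ_ (λ _ → ⊤) reps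
    reps-transversal = proj₁ (proj₂ (proj₂ s-is))

    reps-types : Pointwise (OrbitType τ) reps types
    reps-types = proj₁ (proj₂ (proj₂ (proj₂ s-is)))

    types↭pairs : types ↭ pairs s
    types↭pairs = proj₂ (proj₂ (proj₂ (proj₂ s-is)))

    slots : Permutation (length (pairs s)) (length reps)
    slots = flip (onIndices (↭⇒↭ₛ types↭pairs)) ∘ₚ cast-id (sym (Pointwise-length reps-types))

  rep : Fin (length (pairs s)) → Fin n
  rep i = lookup reps (slots ⟨$⟩ʳ i)

  rep-type : ∀ i → OrbitType τ (rep i) (lookup (pairs s) i)
  rep-type i = subst (OrbitType τ (rep i)) type-of-slot (lookup⁺ reps-types (slots ⟨$⟩ʳ i))
    where
    open ≡-Reasoning
    π : Permutation (length types) (length (pairs s))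
    π = onIndices (↭⇒↭ₛ types↭pairs)

    len : length reps ≡ length types
    len = Pointwise-length reps-types

    type-of-slot : lookup types (cast len (slots ⟨$⟩ʳ i)) ≡ lookup (pairs s) i
    type-of-slot = begin
      lookup types (cast len (cast (sym len) (π ⟨$⟩ˡ i)))
        ≡⟨ cong (lookup types) (cast-involutive len (sym len) _) ⟩
      lookup types (π ⟨$⟩ˡ i)
        ≡⟨ onIndices-lookup (setoid _) (↭⇒↭ₛ types↭pairs) _ ⟩
      lookup (pairs s) (π ⟨$⟩ʳ (π ⟨$⟩ˡ i))
        ≡⟨ cong (lookup (pairs s)) (inverseʳ π) ⟩
      lookup (pairs s) i
        ∎

  rep-distinct : ∀ {i j} → rep i ~ᴳ rep j → i ≡ j
  rep-distinct = ⟨$⟩ʳ-injective slots ∘ lookup-injective ~ᴳ-sym (proj₂ (proj₂ reps-transversal))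

  orbitOf : Fin n → Fin (length (pairs s))
  orbitOf k = slots ⟨$⟩ˡ index (proj₁ (proj₂ reps-transversal) k tt)

  rep-orbitOf : ∀ k → rep (orbitOf k) ~ᴳ k
  rep-orbitOf k = subst (_~ᴳ k) (cong (lookup reps) (sym (inverseʳ slots)))
                        (lookup-index (proj₁ (proj₂ reps-transversal) k tt))

  private
    cyclic : ∀ i → CyclicOrbit (rep i) (fᵢ s i)
    cyclic i = cyclicOrbit (rep-type i)

    position : ∀ k → Σ[ j ∈ Fin (fᵢ s (orbitOf k)) ] (g^ toℕ j ⟨$⟩ʳ rep (orbitOf k) ~ k)
    position k = CyclicOrbit.position (cyclic (orbitOf k)) (rep-orbitOf k)

  typeLabel : Fin n → PartLabel s
  typeLabel k = orbitOf k , proj₁ (position k)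

  typeLabel-sound : ∀ {k i} {j : Fin (fᵢ s i)} → typeLabel k ≡ (i , j) → g^ toℕ j ⟨$⟩ʳ rep i ~ k
  typeLabel-sound {k} refl = proj₂ (position k)

  typeLabel-complete : ∀ {k i} {j : Fin (fᵢ s i)} → g^ toℕ j ⟨$⟩ʳ rep i ~ k → typeLabel k ≡ (i , j)
  typeLabel-complete {k} {i} {j} gʲrᵢ~k
    with rep-distinct (~ᴳ-trans (g^-orbit (toℕ j) (rep i))
                                (~ᴳ-trans (~⇒~ᴳ gʲrᵢ~k) (~ᴳ-sym (rep-orbitOf k))))
  ... | refl = cong (orbitOf k ,_) (CyclicOrbit.distinct (cyclic (orbitOf k))
                                      (~-trans (proj₂ (position k)) (~-sym gʲrᵢ~k)))

  typeLabel-orbits : OrbitLabelling (shift {σ = s}) τ typeLabel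
  typeLabel-orbits = record
    { compatible  = record
      { H-invariant = λ h∈H k → typeLabel-complete (~-trans (proj₂ (position k)) (~-by h∈H k))
      ; g-steps     = λ k → typeLabel-complete
          (~-trans (CyclicOrbit.step (cyclic (orbitOf k)) _) (g-cong (proj₂ (position k))))
      }
    ; fibre⇒orbit = λ {a} same → ~-trans (~-sym (proj₂ (position a))) (typeLabel-sound (sym same))
    }

  typeLabel-fibres : ∀ q → HasSize (λ k → typeLabel k ≡ q) (eᵢ s (proj₁ q))
  typeLabel-fibres (i , j) =
    HasSize-resp typeLabel-complete typeLabel-sound (proj₁ (rep-type i) _ (g^-orbit (toℕ j) (rep i)))

mainTheorem14 : ∀ {n} (τ : AdmPair n) (σ : FactType n) (Tσ : AdmPair n) → IsTauSigma σ Tσ →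
                  (sτ : FactType n) → IsS τ sτ → (Tsτ : AdmPair n) → IsTauSigma sτ Tsτ →
                  (τ ≲ Tσ) ⇔ (Tsτ ≲ Tσ)
mainTheorem14 τ σ Tσ Tσ-is sτ sτ-is Tsτ Tsτ-is = mk⇔
  (λ (l , τ≤lTσl⁻¹) → ρ · l ,
     from (Tσ.≤Conj⇔compatible (ρ · l))
       (relabel-compatible ρ typeLabel-orbits (compatible Tsτ.label-orbits) ρ-relabels
          (to (Tσ.≤Conj⇔compatible l) τ≤lTσl⁻¹)))
  (λ (l , Tsτ≤lTσl⁻¹) → ρ ⁻¹ · l ,
     from (Tσ.≤Conj⇔compatible (ρ ⁻¹ · l))
       (relabel-compatible (ρ ⁻¹) Tsτ.label-orbits (compatible typeLabel-orbits)
          (relabelled-inverse ρ ρ-relabels)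
          (to (Tσ.≤Conj⇔compatible l) Tsτ≤lTσl⁻¹)))
  where
  module Tσ = TauSigma σ Tσ Tσ-is
  module Tsτ = TauSigma sτ Tsτ Tsτ-is
  open TypeLabelling τ sτ sτ-is using (typeLabel; typeLabel-orbits; typeLabel-fibres)
  open OrbitLabelling using (compatible)

  relabelling : Σ[ ρ ∈ Perm _ ] (∀ k → Tsτ.label (ρ ⟨$⟩ʳ k) ≡ typeLabel k)
  relabelling = equalFibreSizes⇒relabelling (eᵢ sτ ∘ proj₁) typeLabel-fibres Tsτ.label-fibres

  ρ : Perm _
  ρ = proj₁ relabelling

  ρ-relabels : ∀ k → Tsτ.label (ρ ⟨$⟩ʳ k) ≡ typeLabel k
  ρ-relabels = proj₂ relabelling
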